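{- Let $k$, $n$, $r$ be nonnegative integers and let $X$ be the set of labeled lattice sequences of type $(k,n,r)$. For $(\lambda,L)\in X$ with $\lambda$ of shape $\alpha$, assign the weight $\mathrm{wt}((\lambda,L))=\mathrm{sign}(\lambda)=(-1)^{|\alpha|-\ell(\alpha)}$. Then \[\sum_{(\lambda,L)\in X}\mathrm{wt}((\lambda,L))=\sum_{i=0}^{k}\binom{(r+1)i+n}{i}.\]
   Context: A composition $\alpha=(\alpha_1,\dots,\alpha_j)$ is a finite (possibly empty) sequence of positive integers; $|\alpha|$ is the sum of its parts, $\ell(\alpha)$ the number of parts, and $\mathrm{sign}(\alpha)=(-1)^{|\alpha|-\ell(\alpha)}$. $\mathcal{C}(k,r)$ is the set of all compositions $\alpha$ with $|\alpha|\le k$ and $2\le\alpha_i\le r+1$ for every part (including the empty composition). A labeled tableau of shape $\alpha$ is a filling of the Young diagram of $\alpha$ (left-justified rows, row $i$ having $\alpha_i$ boxes) in which the first box of each row is empty and the remaining boxes of each row contain nonnegative integers strictly increasing from left to right; $\Lambda(\alpha,r)$ is the set of such tableaux with all labels less than $r$, and the sign of $\lambda\in\Lambda(\alpha,r)$ is $\mathrm{sign}(\alpha)$. A lattice sequence of width $m$ and height $h$ is a sequence $(L_0,L_1,\dots,L_{m+1})$ of integers with $0=L_0\le L_1\le\dots\le L_{m+1}=h$; $\mathcal{L}(m,h)$ denotes the set of these. A labeled lattice sequence of type $(k,n,r)$ is a pair $(\lambda,L)$ where $\lambda\in\Lambda(\alpha,r)$ for some $\alpha\in\mathcal{C}(k,r)$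 and $L\in\mathcal{L}(rk+n+1+\ell(\alpha),\,k-|\alpha|)$. -}

module Defs where

open import Data.Nat using (ℕ; zero; suc; _+_; _*_; _∸_; _≤_; _<_)
open import Data.Nat.Combinatorics using (_C_)
open import Data.Integer as ℤ using (ℤ; +_; -[1+_])
open import Data.List using (List; []; _∷_; _∷ʳ_; length; map; upTo)
open import Data.Nat.ListAction using (sum)
open import Data.List.Relation.Unary.All using (All)
open import Data.List.Relation.Binary.Pointwise using (Pointwise)
open import Data.List.Relation.Unary.Linked using (Linked)
open import Data.Product using (Σ; _×_; ∃)
open import Relation.Binary.PropositionalEquality using (_≡_)

Composition : Set
Composition = List ℕ

size : Composition → ℕ
size = sum

len : Composition → ℕ
len = length

minusOnePow : ℕ → ℤ
minusOnePow zero = + 1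
minusOnePow (suc m) = ℤ.- minusOnePow m

signC : Composition → ℤ
signC α = minusOnePow (size α ∸ len α)

InC : ℕ → ℕ → Composition → Set
InC k r α = (size α ≤ k) × All (λ a → (2 ≤ a) × (a ≤ suc r)) α

-- A labeled tableau is represented by its rows of labels (the first,
-- empty, box of each row is not stored): row i of λ lists the labels
-- in boxes 2..α_i of row i.
Tableau : Set
Tableau = List (List ℕ)

RowOK : ℕ → ℕ → List ℕ → Set
RowOK r a row = (suc (length row) ≡ a) × Linked _<_ row × All (_< r) row

InΛ : Composition → ℕ → Tableau → Set
InΛ α r λt = Pointwise (RowOK r) α λt

InLattice : ℕ → ℕ → List ℕ → Set
InLattice m h L =
  Σ (List ℕ) (λ M → (length M ≡ m) × (L ≡ 0 ∷ (M ∷ʳ h)) × Linked _≤_ L)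

-- Candidate labeled lattice sequences: triples (α, λ, L).  (The shape α
-- is recorded explicitly; it is determined by λ anyway.)
LLS : Set
LLS = Composition × Tableau × List ℕ

InX : ℕ → ℕ → ℕ → LLS → Set
InX k n r (α Data.Product., λt Data.Product., L) =
  InC k r α × InΛ α r λt × InLattice (r * k + n + 1 + len α) (k ∸ size α) L

wt : LLS → ℤ
wt (α Data.Product., _) = signC α

sumℤ : List ℤ → ℤ
sumℤ [] = + 0
sumℤ (x ∷ xs) = x ℤ.+ sumℤ xs

rhs : ℕ → ℕ → ℕ → ℕ
rhs k n r = sum (map (λ i → (suc r * i + n) C i) (upTo (suc k)))

{-# OPTIONS --safe #-}
module Submission where

-- Let S_w be the generating function, in the height h, of the signed count of the
-- (α, λ, L) with |α| ≤ h whose lattice sequence has width w + ℓ(α) and height h - |α|.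
-- Those with empty tableau contribute (1 - x)^-(w+1).  Removing the first row of a
-- nonempty tableau, a nonempty strictly increasing list ρ of labels below r, multiplies
-- the sign by (-1)^|ρ|, raises w by one and lowers h by |ρ| + 1; summing (-x)^|ρ| over
-- all such ρ gives (1 - x)^r - 1.  Hence
--   S_w = (1 - x)^-(w+1) + x ((1 - x)^r - 1) S_(w+1),
-- which is solved by S_w = (1 - x)^-w / (1 - x (1 - x)^r).  For w = rk + n + 1 the
-- coefficient of x^k is ∑_{i ≤ k} [x^(k-i)] (1 - x)^-(w - ri) = ∑_{j ≤ k} binom((r+1)j + n, j).

open import Defs
open import Data.Nat as ℕ using (ℕ; zero; suc; _≤_; _<_; z≤n; s≤s; z<s; _∸_)
import Data.Nat.Properties as ℕP
open import Data.Integer using (ℤ; +_; _+_; _-_; -_; _*_; -1ℤ)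
import Data.Integer.Properties as ℤP
open import Data.List using (List; []; _∷_; [_]; _++_; map; concatMap; length; _∷ʳ_; upTo)
import Data.List.Properties as LP
open import Data.List.Membership.Propositional using (_∈_; _∉_)
open import Data.List.Membership.Propositional.Properties
  using (∈-++⁺ˡ; ∈-++⁺ʳ; ∈-++⁻; ∈-map⁺; ∈-map⁻)
open import Data.List.Membership.Propositional.Properties.WithK using (unique∧set⇒bag)
open import Data.List.Relation.Unary.Any using (here; there)
open import Data.List.Relation.Unary.All as All using (All; []; _∷_)
open import Data.List.Relation.Unary.All.Properties using (∷ʳ⁻)
import Data.List.Relation.Unary.AllPairs as AllPairs
open import Data.List.Relation.Unary.Linked as Linked using (Linked; []; [-]; _∷_)
open import Data.List.Relation.Binary.Pointwise using ([]; _∷_)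
open import Data.List.Relation.Unary.Linked.Properties using (Linked⇒All; Linked⇒AllPairs)
open import Data.List.Relation.Unary.Unique.Propositional using (Unique; []; _∷_)
import Data.List.Relation.Unary.Unique.Propositional.Properties as Unique
open import Data.List.Relation.Binary.Permutation.Propositional using (_↭_; refl; prep; swap; trans)
import Data.List.Relation.Binary.Permutation.Propositional.Properties as ↭
open import Data.List.Relation.Binary.BagAndSetEquality using (∼bag⇒↭)
open import Data.Product using (_×_; _,_; proj₁; proj₂; ∃₂)
open import Data.Sum using (inj₁; inj₂)
open import Data.Empty using (⊥-elim)
open import Relation.Nullary using (¬_)
open import Function using (_∘_; _∘′_; mk⇔)
open import Relation.Binary.PropositionalEquality
  using (_≡_; _≢_; _≗_; refl; sym; cong; cong₂; subst; subst₂; module ≡-Reasoning)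
  renaming (trans to ≡-trans)
open import Algebra.Properties.CommutativeSemigroup ℤP.+-commutativeSemigroup using (x∙yz≈y∙xz)
open import Data.Integer.Tactic.RingSolver using (solve-∀)
import Data.Nat.Tactic.RingSolver as ℕSolver
open import Data.Nat.ListAction using (sum)
open import Data.Nat.ListAction.Properties using (sum-++)
open import Data.Nat.Combinatorics using (_C_; nCn≡1; nCk+nC[k+1]≡[n+1]C[k+1])
open ≡-Reasoning

-- Signed sums over duplicate-free enumerations

sumOver : {A : Set} → (A → ℤ) → List A → ℤ
sumOver f xs = sumℤ (map f xs)

sumℤ-↭ : {xs ys : List ℤ} → xs ↭ ys → sumℤ xs ≡ sumℤ ys
sumℤ-↭ refl         = refl
sumℤ-↭ (prep x p)   = cong (λ s → x + s) (sumℤ-↭ p)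
sumℤ-↭ (swap x y p) = ≡-trans (cong (λ s → x + (y + s)) (sumℤ-↭ p)) (x∙yz≈y∙xz x y _)
sumℤ-↭ (trans p q)  = ≡-trans (sumℤ-↭ p) (sumℤ-↭ q)

record Enumerates {A : Set} (P : A → Set) (xs : List A) : Set where
  field
    unique   : Unique xs
    sound    : ∀ {x} → x ∈ xs → P x
    complete : ∀ {x} → P x → x ∈ xs
open Enumerates

sumOver-enumerations : {A : Set} {P : A → Set} {xs ys : List A} (f : A → ℤ) →
  Enumerates P xs → Enumerates P ys → sumOver f xs ≡ sumOver f ys
sumOver-enumerations f exs eys = sumℤ-↭ (↭.map⁺ f (∼bag⇒↭ (unique∧set⇒bag (unique exs) (unique eys)
  (mk⇔ (complete eys ∘ sound exs) (complete exs ∘ sound eys)))))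

module _ {A : Set} where

  sumOver-++ : (f : A → ℤ) (xs ys : List A) → sumOver f (xs ++ ys) ≡ sumOver f xs + sumOver f ys
  sumOver-++ f []       ys = sym (ℤP.+-identityˡ _)
  sumOver-++ f (x ∷ xs) ys = ≡-trans (cong (λ s → f x + s) (sumOver-++ f xs ys)) (sym (ℤP.+-assoc (f x) _ _))

  sumOver-cong : {f g : A → ℤ} (xs : List A) → (∀ {x} → x ∈ xs → f x ≡ g x) → sumOver f xs ≡ sumOver g xs
  sumOver-cong []       eq = refl
  sumOver-cong (x ∷ xs) eq = cong₂ _+_ (eq (here refl)) (sumOver-cong xs (eq ∘ there))

  sumOver-*ˡ : (c : ℤ) (f : A → ℤ) (xs : List A) → sumOver (λ x → c * f x) xs ≡ c * sumOver f xs
  sumOver-*ˡ c f []       = sym (ℤP.*-zeroʳ c)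
  sumOver-*ˡ c f (x ∷ xs) =
    ≡-trans (cong (λ s → c * f x + s) (sumOver-*ˡ c f xs)) (sym (ℤP.*-distribˡ-+ c (f x) _))

  sumOver-map : {B : Set} (f : B → ℤ) (g : A → B) (xs : List A) → sumOver f (map g xs) ≡ sumOver (f ∘ g) xs
  sumOver-map f g xs = cong sumℤ (sym (LP.map-∘ xs))

  sumOver-one : (xs : List A) → sumOver (λ _ → + 1) xs ≡ + length xs
  sumOver-one []       = refl
  sumOver-one (x ∷ xs) = cong (λ s → + 1 + s) (sumOver-one xs)

module _ {A B C : Set} (f : A → B → C) where

  pairsWith : List A → (A → List B) → List C
  pairsWith xs G = concatMap (λ x → map (f x) (G x)) xs

  ∈-pairsWith⁺ : ∀ {xs G x y} → x ∈ xs → y ∈ G x → f x y ∈ pairsWith xs G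
  ∈-pairsWith⁺ {G = G} (here refl) y∈ = ∈-++⁺ˡ (∈-map⁺ (f _) y∈)
  ∈-pairsWith⁺ {x′ ∷ _} {G} (there x∈) y∈ = ∈-++⁺ʳ (map (f x′) (G x′)) (∈-pairsWith⁺ x∈ y∈)

  ∈-pairsWith⁻ : ∀ xs {G z} → z ∈ pairsWith xs G → ∃₂ λ x y → x ∈ xs × y ∈ G x × z ≡ f x y
  ∈-pairsWith⁻ (x ∷ xs) {G} z∈ with ∈-++⁻ (map (f x) (G x)) z∈
  ... | inj₁ z∈fx with y , y∈ , refl ← ∈-map⁻ (f x) z∈fx = x , y , here refl , y∈ , refl
  ... | inj₂ z∈rest with x′ , y , x′∈ , y∈ , refl ← ∈-pairsWith⁻ xs z∈rest =
    x′ , y , there x′∈ , y∈ , refl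

  pairsWith-unique : (∀ {x x′ y y′} → f x y ≡ f x′ y′ → x ≡ x′ × y ≡ y′) →
    ∀ {xs G} → Unique xs → (∀ x → Unique (G x)) → Unique (pairsWith xs G)
  pairsWith-unique f-inj {[]}     []            uG = []
  pairsWith-unique f-inj {x ∷ xs} {G} (x∉ ∷ uxs) uG =
    Unique.++⁺ (Unique.map⁺ (proj₂ ∘ f-inj) (uG x)) (pairsWith-unique f-inj uxs uG) disjoint
    where
    disjoint : ∀ {z} → ¬ (z ∈ map (f x) (G x) × z ∈ pairsWith xs G)
    disjoint (z∈fx , z∈rest) with y , _ , refl ← ∈-map⁻ (f x) z∈fx
                            | x′ , _ , x′∈ , _ , eq ← ∈-pairsWith⁻ xs z∈rest
      = All.lookup x∉ x′∈ (proj₁ (f-inj eq))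

  sumOver-pairsWith : (wt : C → ℤ) (xs : List A) (G : A → List B) →
    sumOver wt (pairsWith xs G) ≡ sumOver (λ x → sumOver (wt ∘ f x) (G x)) xs
  sumOver-pairsWith wt []       G = refl
  sumOver-pairsWith wt (x ∷ xs) G = begin
    sumOver wt (map (f x) (G x) ++ pairsWith xs G)
      ≡⟨ sumOver-++ wt (map (f x) (G x)) _ ⟩
    sumOver wt (map (f x) (G x)) + sumOver wt (pairsWith xs G)
      ≡⟨ cong₂ _+_ (sumOver-map wt (f x) (G x)) (sumOver-pairsWith wt xs G) ⟩
    sumOver (wt ∘ f x) (G x) + sumOver (λ x → sumOver (wt ∘ f x) (G x)) xs ∎

iter : {A : Set} → ℕ → (A → A) → A → A
iter zero    F x = x
iter (suc n) F x = F (iter n F x)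

module _ {A : Set} (F : A → A) where

  iter-suc′ : ∀ n x → iter n F (F x) ≡ F (iter n F x)
  iter-suc′ zero    x = refl
  iter-suc′ (suc n) x = cong F (iter-suc′ n x)

  iter-+ : ∀ m n x → iter (m ℕ.+ n) F x ≡ iter m F (iter n F x)
  iter-+ zero    n x = refl
  iter-+ (suc m) n x = cong F (iter-+ m n x)

-- Sequences are coefficient lists of formal power series in x: shift, diff and psum
-- multiply by x, 1 - x and 1/(1 - x), and δ is the series 1.
Seq : Set
Seq = ℕ → ℤ

δ : Seq
δ zero    = + 1
δ (suc _) = + 0

shift : Seq → Seq
shift f zero    = + 0
shift f (suc h) = f h

diff : Seq → Seq
diff f h = f h - shift f h

psum : Seq → Seq
psum f zero    = f zero
psum f (suc h) = psum f h + f (suc h)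

infixl 6 _⊕_ _⊖_

_⊕_ : Seq → Seq → Seq
(f ⊕ g) h = f h + g h

_⊖_ : Seq → Seq → Seq
(f ⊖ g) h = f h - g h

AgreeBelow : ℕ → Seq → Seq → Set
AgreeBelow h f g = ∀ {i} → i < h → f i ≡ g i

Causal : (Seq → Seq) → Set
Causal F = ∀ {f g} h → AgreeBelow h f g → AgreeBelow h (F f) (F g)

Commute : (Seq → Seq) → (Seq → Seq) → Set
Commute F G = ∀ f → F (G f) ≗ G (F f)

Additive : (Seq → Seq) → Set
Additive F = ∀ f g → F (f ⊕ g) ≗ F f ⊕ F g

causal⇒cong : ∀ {F} → Causal F → ∀ {f g} → f ≗ g → F f ≗ F g
causal⇒cong F-causal f≗g i = F-causal (suc i) (λ {j} _ → f≗g j) ℕP.≤-refl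

iter-causal : ∀ {F} → Causal F → ∀ n → Causal (iter n F)
iter-causal F-causal zero    h agree = agree
iter-causal F-causal (suc n) h agree = F-causal h (iter-causal F-causal n h agree)

iter-additive : ∀ {F} → Causal F → Additive F → ∀ n → Additive (iter n F)
iter-additive F-causal F-additive zero    f g i = refl
iter-additive {F} F-causal F-additive (suc n) f g i =
  ≡-trans (causal⇒cong F-causal (iter-additive F-causal F-additive n f g) i) (F-additive (iter n F f) (iter n F g) i)

iter-inverse : ∀ {F G} → Causal F → (∀ f → F (G f) ≗ f) → ∀ n f → iter n F (iter n G f) ≗ f
iter-inverse F-causal FG zero    f i = refl
iter-inverse {F} {G} F-causal FG (suc n) f i = begin
  F (iter n F (G (iter n G f))) i ≡⟨ cong (λ s → s i) (iter-suc′ F n _) ⟨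
  iter n F (F (G (iter n G f))) i ≡⟨ causal⇒cong (iter-causal F-causal n) (FG (iter n G f)) i ⟩
  iter n F (iter n G f) i         ≡⟨ iter-inverse F-causal FG n f i ⟩
  f i                             ∎

iter-commute : ∀ {F G} → Causal F → Causal G → Commute F G → ∀ m n → Commute (iter m F) (iter n G)
iter-commute {F} {G} F-causal G-causal FG = go
  where
  one : ∀ n → Commute F (iter n G)
  one zero    f i = refl
  one (suc n) f i = ≡-trans (FG (iter n G f) i) (causal⇒cong G-causal (one n f) i)

  go : ∀ m n → Commute (iter m F) (iter n G)
  go zero    n f i = refl
  go (suc m) n f i = ≡-trans (causal⇒cong F-causal (go m n f) i) (one n (iter m F f) i)

shift-agree : ∀ {f g} h → AgreeBelow h f g → AgreeBelow (suc h) (shift f) (shift g)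
shift-agree h agree {zero}  _         = refl
shift-agree h agree {suc i} (s≤s i<h) = agree i<h

shift-causal : Causal shift
shift-causal h agree i<h = shift-agree h agree (ℕP.m<n⇒m<1+n i<h)

diff-causal : Causal diff
diff-causal h agree i<h = cong₂ _-_ (agree i<h) (shift-causal h agree i<h)

psum-causal : Causal psum
psum-causal h agree {zero}  i<h = agree i<h
psum-causal h agree {suc i} i<h = cong₂ _+_ (psum-causal h agree (ℕP.<⇒≤ i<h)) (agree i<h)

psum-additive : Additive psum
psum-additive f g zero    = refl
psum-additive f g (suc h) =
  ≡-trans (cong (_+ (f (suc h) + g (suc h))) (psum-additive f g h))
          (swap-middle (psum f h) (psum g h) (f (suc h)) (g (suc h)))
  where
  swap-middle : ∀ a b c d → (a + b) + (c + d) ≡ (a + c) + (b + d)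
  swap-middle = solve-∀

diff-psum : ∀ f → diff (psum f) ≗ f
diff-psum f zero    = ℤP.+-identityʳ (f zero)
diff-psum f (suc h) = cancel (psum f h) (f (suc h))
  where
  cancel : ∀ a b → (a + b) - a ≡ b
  cancel = solve-∀

psum-diff : ∀ f → psum (diff f) ≗ f
psum-diff f zero    = ℤP.+-identityʳ (f zero)
psum-diff f (suc h) = ≡-trans (cong (_+ diff f (suc h)) (psum-diff f h)) (telescope (f h) (f (suc h)))
  where
  telescope : ∀ a b → a + (b - a) ≡ b
  telescope = solve-∀

psum-shift : Commute psum shift
psum-shift f zero          = refl
psum-shift f (suc zero)    = ℤP.+-identityˡ (f zero)
psum-shift f (suc (suc h)) = cong (_+ f (suc h)) (psum-shift f (suc h))

diff-shift : Commute diff shift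
diff-shift f zero    = refl
diff-shift f (suc h) = refl

diff-psum-commute : Commute diff psum
diff-psum-commute f h = ≡-trans (diff-psum f h) (sym (psum-diff f h))

shift-⊖ : ∀ f g → shift (f ⊖ g) ≗ shift f ⊖ shift g
shift-⊖ f g zero    = refl
shift-⊖ f g (suc h) = refl

iter-psum-zero : ∀ m f → iter m psum f zero ≡ f zero
iter-psum-zero zero    f = refl
iter-psum-zero (suc m) f = iter-psum-zero m f

psum-δ : ∀ h → psum δ h ≡ + 1
psum-δ zero    = refl
psum-δ (suc h) = ≡-trans (ℤP.+-identityʳ (psum δ h)) (psum-δ h)

psum-δ-binomial : ∀ m h → iter (suc m) psum δ h ≡ + ((m ℕ.+ h) C h)
psum-δ-binomial zero    h       = ≡-trans (psum-δ h) (cong +_ (sym (nCn≡1 h)))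
psum-δ-binomial (suc m) zero    = psum-δ-binomial m zero
psum-δ-binomial (suc m) (suc h) = begin
  iter (suc (suc m)) psum δ h + iter (suc m) psum δ (suc h)
    ≡⟨ cong₂ _+_ (psum-δ-binomial (suc m) h) (psum-δ-binomial m (suc h)) ⟩
  + ((suc m ℕ.+ h) C h) + + ((m ℕ.+ suc h) C suc h)
    ≡⟨ cong (λ n → + ((suc m ℕ.+ h) C h) + + (n C suc h)) (ℕP.+-suc m h) ⟩
  + ((suc m ℕ.+ h) C h ℕ.+ (suc m ℕ.+ h) C suc h)
    ≡⟨ cong +_ (nCk+nC[k+1]≡[n+1]C[k+1] (suc m ℕ.+ h) h) ⟩
  + (suc (suc m ℕ.+ h) C suc h)
    ≡⟨ cong (λ n → + (suc n C suc h)) (ℕP.+-suc m h) ⟨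
  + ((suc m ℕ.+ suc h) C suc h) ∎

shiftList : {A : Set} → ℕ → (ℕ → List A) → ℕ → List A
shiftList zero    F h       = F h
shiftList (suc a) F zero    = []
shiftList (suc a) F (suc h) = shiftList a F h

module _ {A : Set} {F : ℕ → List A} where

  ∈-shiftList⁺ : ∀ a {h x} → a ≤ h → x ∈ F (h ∸ a) → x ∈ shiftList a F h
  ∈-shiftList⁺ zero    _         x∈ = x∈
  ∈-shiftList⁺ (suc a) (s≤s a≤h) x∈ = ∈-shiftList⁺ a a≤h x∈

  ∈-shiftList⁻ : ∀ a {h x} → x ∈ shiftList a F h → a ≤ h × x ∈ F (h ∸ a)
  ∈-shiftList⁻ zero            x∈ = z≤n , x∈
  ∈-shiftList⁻ (suc a) {suc h} x∈ with a≤h , x∈′ ← ∈-shiftList⁻ a x∈ = s≤s a≤h , x∈′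

  shiftList-unique : (∀ h → Unique (F h)) → ∀ a h → Unique (shiftList a F h)
  shiftList-unique u zero    h       = u h
  shiftList-unique u (suc a) zero    = []
  shiftList-unique u (suc a) (suc h) = shiftList-unique u a h

  sumOver-shiftList : (wt : A → ℤ) → ∀ a h →
    sumOver wt (shiftList a F h) ≡ iter a shift (λ h′ → sumOver wt (F h′)) h
  sumOver-shiftList wt zero    h       = refl
  sumOver-shiftList wt (suc a) zero    = refl
  sumOver-shiftList wt (suc a) (suc h) = sumOver-shiftList wt a h

-- Strictly and weakly increasing lists

Increasing : ℕ → ℕ → List ℕ → Set
Increasing lo top ρ = Linked _<_ ρ × All (lo ≤_) ρ × All (_< top) ρ

increasing⁺ : ℕ → ℕ → List (List ℕ)
increasing⁺ lo zero    = []
increasing⁺ lo (suc c) = [ lo ] ∷ map (lo ∷_) (increasing⁺ (suc lo) c) ++ increasing⁺ (suc lo) c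

module _ {lo top : ℕ} where

  increasing-cons : ∀ {ρ} → lo < top → Increasing (suc lo) top ρ → Increasing lo top (lo ∷ ρ)
  increasing-cons {[]}    lo<top _                           = [-] , ℕP.≤-refl ∷ [] , lo<top ∷ []
  increasing-cons {_ ∷ _} lo<top (lk , lo<y ∷ above , below) =
    lo<y ∷ lk , ℕP.≤-refl ∷ All.map ℕP.<⇒≤ (lo<y ∷ above) , lo<top ∷ below

  increasing-weaken : ∀ {ρ} → Increasing (suc lo) top ρ → Increasing lo top ρ
  increasing-weaken (lk , above , below) = lk , All.map ℕP.<⇒≤ above , below

increasing⁺-sound : ∀ {lo c top ρ} → lo ℕ.+ c ≡ top → ρ ∈ increasing⁺ lo c →
                    ρ ≢ [] × Increasing lo top ρ
increasing⁺-sound {lo} {suc c} refl (here refl) = (λ ()) , increasing-cons (ℕP.m<m+n lo (s≤s z≤n)) ([] , [] , [])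
increasing⁺-sound {lo} {suc c} refl (there ρ∈) with ∈-++⁻ (map (lo ∷_) (increasing⁺ (suc lo) c)) ρ∈
... | inj₁ ρ∈′ with ∈-map⁻ (lo ∷_) ρ∈′
...   | σ , σ∈ , refl =
  (λ ()) , increasing-cons (ℕP.m<m+n lo (s≤s z≤n)) (proj₂ (increasing⁺-sound (sym (ℕP.+-suc lo c)) σ∈))
increasing⁺-sound {lo} {suc c} refl (there ρ∈) | inj₂ ρ∈′
  with ρ≢[] , inc ← increasing⁺-sound (sym (ℕP.+-suc lo c)) ρ∈′ = ρ≢[] , increasing-weaken inc

increasing⁺-complete : ∀ {lo c top ρ} → lo ℕ.+ c ≡ top → ρ ≢ [] → Increasing lo top ρ →
                       ρ ∈ increasing⁺ lo c
increasing⁺-complete {ρ = []} _ ρ≢[] _ = ⊥-elim (ρ≢[] refl)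
increasing⁺-complete {lo} {zero} {ρ = x ∷ _} refl _ (_ , lo≤x ∷ _ , x<lo+0 ∷ _) =
  ⊥-elim (ℕP.<⇒≱ (subst (x <_) (ℕP.+-identityʳ lo) x<lo+0) lo≤x)
increasing⁺-complete {lo} {suc c} {ρ = x ∷ σ} refl _ (lk , lo≤x ∷ _ , below)
  with ℕP.m≤n⇒m<n∨m≡n lo≤x | σ
... | inj₂ refl | []    = here refl
... | inj₂ refl | _ ∷ _ = there (∈-++⁺ˡ (∈-map⁺ (lo ∷_)
      (increasing⁺-complete (sym (ℕP.+-suc lo c)) (λ ())
        (Linked.tail lk , AllPairs.head (Linked⇒AllPairs ℕP.<-trans lk) , All.tail below))))
... | inj₁ lo<x | _     = there (∈-++⁺ʳ (map (lo ∷_) (increasing⁺ (suc lo) c))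
      (increasing⁺-complete (sym (ℕP.+-suc lo c)) (λ ()) (lk , Linked⇒All ℕP.<-trans lo<x lk , below)))

increasing⁺-unique : ∀ lo c → Unique (increasing⁺ lo c)
increasing⁺-unique lo zero    = []
increasing⁺-unique lo (suc c) =
  All.tabulate singleton-new ∷ Unique.++⁺ (Unique.map⁺ (proj₂ ∘ LP.∷-injective) rest-unique) rest-unique disjoint
  where
  rest-unique = increasing⁺-unique (suc lo) c

  rest-sound : ∀ {ρ} → ρ ∈ increasing⁺ (suc lo) c → ρ ≢ [] × Increasing (suc lo) (lo ℕ.+ suc c) ρ
  rest-sound = increasing⁺-sound (sym (ℕP.+-suc lo c))

  lo∉rest : ∀ {σ} → lo ∷ σ ∉ increasing⁺ (suc lo) c
  lo∉rest lo∷σ∈ with _ , _ , lo<lo ∷ _ , _ ← rest-sound lo∷σ∈ = ℕP.<-irrefl refl lo<lo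

  singleton-new : ∀ {ρ} → ρ ∈ map (lo ∷_) (increasing⁺ (suc lo) c) ++ increasing⁺ (suc lo) c → [ lo ] ≢ ρ
  singleton-new ρ∈ refl with ∈-++⁻ (map (lo ∷_) (increasing⁺ (suc lo) c)) ρ∈
  ... | inj₁ ρ∈′ with _ , []∈ , refl ← ∈-map⁻ (lo ∷_) ρ∈′ = proj₁ (rest-sound []∈) refl
  ... | inj₂ ρ∈′ = lo∉rest ρ∈′

  disjoint : ∀ {ρ} → ¬ (ρ ∈ map (lo ∷_) (increasing⁺ (suc lo) c) × ρ ∈ increasing⁺ (suc lo) c)
  disjoint (ρ∈ , ρ∈′) with _ , _ , refl ← ∈-map⁻ (lo ∷_) ρ∈ = lo∉rest ρ∈′

increasing⁺-length : ∀ lo c {ρ} → ρ ∈ increasing⁺ lo c → length ρ ≤ c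
increasing⁺-length lo (suc c) (here refl) = s≤s z≤n
increasing⁺-length lo (suc c) (there ρ∈) with ∈-++⁻ (map (lo ∷_) (increasing⁺ (suc lo) c)) ρ∈
... | inj₁ ρ∈′ with _ , σ∈ , refl ← ∈-map⁻ (lo ∷_) ρ∈′ = s≤s (increasing⁺-length (suc lo) c σ∈)
... | inj₂ ρ∈′ = ℕP.m≤n⇒m≤1+n (increasing⁺-length (suc lo) c ρ∈′)

signedShift : ℕ → Seq → Seq
signedShift n g h = minusOnePow n * iter n shift g h

-- (1 - x)^c - 1 expanded as the sum of (-x)^|ρ| over the nonempty subsets ρ of [lo, lo + c).
increasing⁺-binomial : ∀ lo c g h →
  sumOver (λ ρ → signedShift (length ρ) g h) (increasing⁺ lo c) ≡ iter c diff g h - g h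
increasing⁺-binomial lo zero    g h = sym (ℤP.+-inverseʳ (g h))
increasing⁺-binomial lo (suc c) g h = begin
  signedShift 1 g h + sumOver term (map (lo ∷_) rest ++ rest)
    ≡⟨ cong (λ s → signedShift 1 g h + s) (sumOver-++ term (map (lo ∷_) rest) rest) ⟩
  signedShift 1 g h + (sumOver term (map (lo ∷_) rest) + sumOver term rest)
    ≡⟨ cong (λ s → signedShift 1 g h + (s + sumOver term rest))
            (≡-trans (sumOver-map term (lo ∷_) rest) prepend) ⟩
  signedShift 1 g h + (-1ℤ * sumOver (λ ρ → signedShift (length ρ) (shift g) h) rest + sumOver term rest)
    ≡⟨ cong₂ (λ s t → signedShift 1 g h + (-1ℤ * s + t)) (increasing⁺-binomial (suc lo) c (shift g) h)
                                                        (increasing⁺-binomial (suc lo) c g h) ⟩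
  -1ℤ * shift g h + (-1ℤ * (iter c diff (shift g) h - shift g h) + (iter c diff g h - g h))
    ≡⟨ cong (λ s → -1ℤ * shift g h + (-1ℤ * (s - shift g h) + (iter c diff g h - g h)))
            (iter-commute diff-causal shift-causal diff-shift c 1 g h) ⟩
  -1ℤ * shift g h + (-1ℤ * (shift (iter c diff g) h - shift g h) + (iter c diff g h - g h))
    ≡⟨ rearrange (shift g h) (shift (iter c diff g) h) (iter c diff g h) (g h) ⟩
  iter (suc c) diff g h - g h ∎
  where
  rest = increasing⁺ (suc lo) c
  term = λ ρ → signedShift (length ρ) g h

  prepend-one : ∀ n → signedShift (suc n) g h ≡ -1ℤ * signedShift n (shift g) h
  prepend-one n = ≡-trans (sign-out (minusOnePow n) (shift (iter n shift g) h))
                          (cong (λ f → -1ℤ * (minusOnePow n * f h)) (sym (iter-suc′ shift n g)))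
    where
    sign-out : ∀ a x → - a * x ≡ -1ℤ * (a * x)
    sign-out = solve-∀

  prepend : sumOver (λ σ → signedShift (suc (length σ)) g h) rest
          ≡ -1ℤ * sumOver (λ ρ → signedShift (length ρ) (shift g) h) rest
  prepend = ≡-trans (sumOver-cong rest (λ {σ} _ → prepend-one (length σ))) (sumOver-*ˡ -1ℤ _ rest)

  rearrange : ∀ s t d a → -1ℤ * s + (-1ℤ * (t - s) + (d - a)) ≡ (d - t) - a
  rearrange = solve-∀

Monotone : ℕ → ℕ → ℕ → List ℕ → Set
Monotone m lo top M = length M ≡ m × Linked _≤_ (lo ∷ M ∷ʳ top)

monotone : ℕ → ℕ → ℕ → List (List ℕ)
monotone zero    lo d       = [ [] ]
monotone (suc m) lo zero    = map (lo ∷_) (monotone m lo zero)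
monotone (suc m) lo (suc d) = map (lo ∷_) (monotone m lo (suc d)) ++ monotone (suc m) (suc lo) d

module _ {m lo top : ℕ} where

  monotone-cons : ∀ {M} → Monotone m lo top M → Monotone (suc m) lo top (lo ∷ M)
  monotone-cons (len , lk) = cong suc len , ℕP.≤-refl ∷ lk

  monotone-weaken : ∀ {M} → Monotone m (suc lo) top M → Monotone m lo top M
  monotone-weaken (len , lk) = len , weaken-head lk
    where
    weaken-head : ∀ {xs} → Linked _≤_ (suc lo ∷ xs) → Linked _≤_ (lo ∷ xs)
    weaken-head [-]         = [-]
    weaken-head (lo<y ∷ lk) = ℕP.<⇒≤ lo<y ∷ lk

monotone-sound : ∀ {m lo d top M} → lo ℕ.+ d ≡ top → M ∈ monotone m lo d → Monotone m lo top M
monotone-sound {zero}  {lo} {d} refl (here refl) = refl , ℕP.m≤m+n lo d ∷ [-]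
monotone-sound {suc m} {lo} {zero} e M∈ with _ , M′∈ , refl ← ∈-map⁻ (lo ∷_) M∈ =
  monotone-cons (monotone-sound e M′∈)
monotone-sound {suc m} {lo} {suc d} e M∈ with ∈-++⁻ (map (lo ∷_) (monotone m lo (suc d))) M∈
... | inj₁ M∈′ with _ , M′∈ , refl ← ∈-map⁻ (lo ∷_) M∈′ = monotone-cons (monotone-sound e M′∈)
... | inj₂ M∈′ = monotone-weaken (monotone-sound (≡-trans (sym (ℕP.+-suc lo d)) e) M∈′)

monotone-complete : ∀ {m lo d top M} → lo ℕ.+ d ≡ top → Monotone m lo top M → M ∈ monotone m lo d
monotone-complete {zero}  {M = []} _ _ = here refl
monotone-complete {suc m} {lo} {d} {top} {v ∷ M} e (len , lo≤v ∷ lk) with ℕP.m≤n⇒m<n∨m≡n lo≤v | d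
... | inj₂ refl | zero  = ∈-map⁺ (lo ∷_) (monotone-complete e (ℕP.suc-injective len , lk))
... | inj₂ refl | suc _ = ∈-++⁺ˡ (∈-map⁺ (lo ∷_) (monotone-complete e (ℕP.suc-injective len , lk)))
... | inj₁ lo<v | zero  = ⊥-elim (ℕP.<⇒≱ lo<v (subst (v ≤_) (≡-trans (sym e) (ℕP.+-identityʳ lo)) v≤top))
  where
  v≤top : v ≤ top
  v≤top = proj₂ (∷ʳ⁻ (AllPairs.head (Linked⇒AllPairs ℕP.≤-trans lk)))
... | inj₁ lo<v | suc d′ = ∈-++⁺ʳ (map (lo ∷_) (monotone m lo (suc d′)))
      (monotone-complete (≡-trans (sym (ℕP.+-suc lo d′)) e) (len , lo<v ∷ lk))

monotone-unique : ∀ m lo d → Unique (monotone m lo d)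
monotone-unique zero    lo d       = [] ∷ []
monotone-unique (suc m) lo zero    = Unique.map⁺ (proj₂ ∘ LP.∷-injective) (monotone-unique m lo zero)
monotone-unique (suc m) lo (suc d) =
  Unique.++⁺ (Unique.map⁺ (proj₂ ∘ LP.∷-injective) (monotone-unique m lo (suc d)))
             (monotone-unique (suc m) (suc lo) d) disjoint
  where
  disjoint : ∀ {M} → ¬ (M ∈ map (lo ∷_) (monotone m lo (suc d)) × M ∈ monotone (suc m) (suc lo) d)
  disjoint (M∈ , M∈′) with _ , _ , refl ← ∈-map⁻ (lo ∷_) M∈
                       | _ , lo<lo ∷ _ ← monotone-sound {suc m} {suc lo} {d} refl M∈′ = ℕP.<-irrefl refl lo<lo

monotone-count : ∀ m lo d → + length (monotone m lo d) ≡ iter (suc m) psum δ d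
monotone-count zero    lo d       = sym (psum-δ d)
monotone-count (suc m) lo zero    =
  ≡-trans (cong +_ (LP.length-map (lo ∷_) (monotone m lo zero))) (monotone-count m lo zero)
monotone-count (suc m) lo (suc d) = begin
  + length (map (lo ∷_) (monotone m lo (suc d)) ++ monotone (suc m) (suc lo) d)
    ≡⟨ cong +_ (≡-trans (LP.length-++ (map (lo ∷_) (monotone m lo (suc d))))
                        (cong (ℕ._+ length (monotone (suc m) (suc lo) d))
                              (LP.length-map (lo ∷_) (monotone m lo (suc d))))) ⟩
  + length (monotone m lo (suc d)) + + length (monotone (suc m) (suc lo) d)
    ≡⟨ cong₂ _+_ (monotone-count m lo (suc d)) (monotone-count (suc m) (suc lo) d) ⟩
  iter (suc m) psum δ (suc d) + iter (suc (suc m)) psum δ d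
    ≡⟨ ℤP.+-comm (iter (suc m) psum δ (suc d)) _ ⟩
  iter (suc (suc m)) psum δ (suc d) ∎

-- Labeled lattice sequences

length≤sum : ∀ {α} → All (0 <_) α → length α ≤ size α
length≤sum []       = z≤n
length≤sum (p ∷ ps) = ℕP.+-mono-≤ p (length≤sum ps)

minusOnePow-+ : ∀ a b → minusOnePow (a ℕ.+ b) ≡ minusOnePow a * minusOnePow b
minusOnePow-+ zero    b = sym (ℤP.*-identityˡ (minusOnePow b))
minusOnePow-+ (suc a) b = ≡-trans (cong -_ (minusOnePow-+ a b)) (ℤP.neg-distribˡ-* (minusOnePow a) (minusOnePow b))

addRow : List ℕ → LLS → LLS
addRow ρ (α , λt , L) = suc (length ρ) ∷ α , ρ ∷ λt , L

addRow-injective : ∀ {ρ ρ′ y y′} → addRow ρ y ≡ addRow ρ′ y′ → ρ ≡ ρ′ × y ≡ y′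
addRow-injective {y = _ , _ , _} {y′ = _ , _ , _} refl = refl , refl

wt-addRow : ∀ ρ y → All (0 <_) (proj₁ y) → wt (addRow ρ y) ≡ minusOnePow (length ρ) * wt y
wt-addRow ρ (α , _ , _) positive =
  ≡-trans (cong minusOnePow (ℕP.+-∸-assoc (length ρ) (length≤sum positive)))
          (minusOnePow-+ (length ρ) (size α ∸ len α))

rhs-suc : ∀ k n r → rhs (suc k) n r ≡ rhs k n r ℕ.+ (suc r ℕ.* suc k ℕ.+ n) C suc k
rhs-suc k n r = begin
  sum (map term (upTo (suc (suc k))))               ≡⟨ cong (sum ∘ map term) (LP.upTo-∷ʳ (suc k)) ⟨
  sum (map term (upTo (suc k) ∷ʳ suc k))            ≡⟨ cong sum (LP.map-++ term (upTo (suc k)) [ suc k ]) ⟩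
  sum (map term (upTo (suc k)) ++ [ term (suc k) ]) ≡⟨ sum-++ (map term (upTo (suc k))) [ term (suc k) ] ⟩
  rhs k n r ℕ.+ (term (suc k) ℕ.+ 0)                ≡⟨ cong (rhs k n r ℕ.+_) (ℕP.+-identityʳ (term (suc k))) ⟩
  rhs k n r ℕ.+ term (suc k)                        ∎
  where
  term = λ i → (suc r ℕ.* i ℕ.+ n) C i

module LatticeSequences (r : ℕ) where

  -- InX k n r is InLLS k (r * k + n + 1).
  InLLS : ℕ → ℕ → LLS → Set
  InLLS h w (α , λt , L) = InC h r α × InΛ α r λt × InLattice (w ℕ.+ len α) (h ∸ size α) L

  emptyShape : ℕ → ℕ → List LLS
  emptyShape w h = map (λ M → [] , [] , 0 ∷ (M ∷ʳ h)) (monotone w 0 h)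

  -- Enumerates InLLS h w as soon as h < f; the fuel f only makes the recursion structural.
  lls : ℕ → ℕ → ℕ → List LLS
  lls zero    h w = []
  lls (suc f) h w = emptyShape w h ++
    pairsWith addRow (increasing⁺ 0 r) (λ ρ → shiftList (suc (length ρ)) (λ h′ → lls f h′ (suc w)) h)

  emptyShape-sound : ∀ {w h x} → x ∈ emptyShape w h → InLLS h w x
  emptyShape-sound {w} x∈ with ∈-map⁻ _ x∈
  ... | M , M∈ , refl =
    let len , lk = monotone-sound refl M∈ in (z≤n , []) , [] , M , ≡-trans len (sym (ℕP.+-identityʳ w)) , refl , lk

  emptyShape-complete : ∀ {w h λt L} → InLLS h w ([] , λt , L) → ([] , λt , L) ∈ emptyShape w h
  emptyShape-complete {w} (_ , [] , M , len , refl , lk) =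
    ∈-map⁺ _ (monotone-complete refl (≡-trans len (ℕP.+-identityʳ w) , lk))

  emptyShape-unique : ∀ w h → Unique (emptyShape w h)
  emptyShape-unique w h = Unique.map⁺ lattice-injective (monotone-unique w 0 h)
    where
    lattice-injective : ∀ {M M′} → ([] , [] , 0 ∷ (M ∷ʳ h)) ≡ ([] , [] , 0 ∷ (M′ ∷ʳ h)) → M ≡ M′
    lattice-injective {M} {M′} eq = LP.∷ʳ-injectiveˡ M M′ (proj₂ (LP.∷-injective (cong (proj₂ ∘ proj₂) eq)))

  addRow-sound : ∀ {h w ρ y} → ρ ∈ increasing⁺ 0 r → suc (length ρ) ≤ h →
                 InLLS (h ∸ suc (length ρ)) (suc w) y → InLLS h w (addRow ρ y)
  addRow-sound {h} {w} {ρ} {α , λt , L} ρ∈ a≤h ((size≤ , parts) , rows , lat) with increasing⁺-sound refl ρ∈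
  ... | ρ≢[] , lk , _ , below =
    (size-ok , (2≤1+length ρ≢[] , s≤s (increasing⁺-length 0 r ρ∈)) ∷ parts) ,
    (refl , lk , below) ∷ rows ,
    subst₂ (λ m t → InLattice m t L) (sym (ℕP.+-suc w (len α))) (ℕP.∸-+-assoc h a (size α)) lat
    where
    a = suc (length ρ)
    size-ok : a ℕ.+ size α ≤ h
    size-ok = ℕP.≤-trans (ℕP.+-monoʳ-≤ a size≤) (ℕP.≤-reflexive (ℕP.m+[n∸m]≡n a≤h))
    2≤1+length : ∀ {σ : List ℕ} → σ ≢ [] → 2 ≤ suc (length σ)
    2≤1+length {[]}    σ≢[] = ⊥-elim (σ≢[] refl)
    2≤1+length {_ ∷ _} _    = s≤s (s≤s z≤n)

  lls-sound : ∀ f {h w x} → x ∈ lls f h w → InLLS h w x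
  lls-sound (suc f) {h} {w} x∈ with ∈-++⁻ (emptyShape w h) x∈
  ... | inj₁ x∈e = emptyShape-sound x∈e
  ... | inj₂ x∈p with ∈-pairsWith⁻ addRow (increasing⁺ 0 r) x∈p
  ...   | ρ , y , ρ∈ , y∈ , refl with ∈-shiftList⁻ (suc (length ρ)) y∈
  ...     | a≤h , y∈′ = addRow-sound ρ∈ a≤h (lls-sound f y∈′)

  lls-complete : ∀ f {h w x} → h < f → InLLS h w x → x ∈ lls f h w
  lls-complete (suc f) {x = [] , _ , _} _ iy = ∈-++⁺ˡ (emptyShape-complete iy)
  lls-complete (suc f) {h} {w} {a ∷ α , ρ ∷ λt , L} h<1+f
               ((size≤ , (2≤a , _) ∷ parts) , (refl , lk , below) ∷ rows , lat) =
    ∈-++⁺ʳ (emptyShape w h) (∈-pairsWith⁺ addRow ρ∈ (∈-shiftList⁺ a a≤h (lls-complete f fuel iy)))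
    where
    a≤h : a ≤ h
    a≤h = ℕP.m+n≤o⇒m≤o a size≤
    ρ≢[] : ρ ≢ []
    ρ≢[] refl = ℕP.<-irrefl refl 2≤a
    ρ∈ : ρ ∈ increasing⁺ 0 r
    ρ∈ = increasing⁺-complete refl ρ≢[] (lk , All.tabulate (λ _ → z≤n) , below)
    fuel : h ∸ a < f
    fuel = ℕP.<-≤-trans (ℕP.∸-monoʳ-< (s≤s z≤n) a≤h) (ℕP.≤-pred h<1+f)
    iy : InLLS (h ∸ a) (suc w) (α , λt , L)
    iy = (ℕP.m+n≤o⇒m≤o∸n (size α) (subst (_≤ h) (ℕP.+-comm a (size α)) size≤) , parts) , rows ,
         subst₂ (λ m t → InLattice m t L) (ℕP.+-suc w (len α)) (sym (ℕP.∸-+-assoc h a (size α))) lat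

  lls-unique : ∀ f h w → Unique (lls f h w)
  lls-unique zero    h w = []
  lls-unique (suc f) h w = Unique.++⁺ (emptyShape-unique w h)
    (pairsWith-unique addRow addRow-injective (increasing⁺-unique 0 r)
      (λ ρ → shiftList-unique (λ h′ → lls-unique f h′ (suc w)) (suc (length ρ)) h))
    disjoint
    where
    disjoint : ∀ {x} → ¬ (x ∈ emptyShape w h × x ∈ pairsWith addRow (increasing⁺ 0 r) _)
    disjoint (x∈e , x∈p) with ∈-map⁻ _ x∈e | ∈-pairsWith⁻ addRow (increasing⁺ 0 r) x∈p
    ... | _ , _ , refl | _ , (_ , _ , _) , _ , _ , ()

  lls-enumerates : ∀ {f h} w → h < f → Enumerates (InLLS h w) (lls f h w)
  lls-enumerates {f} {h} w h<f = record
    { unique = lls-unique f h w ; sound = lls-sound f ; complete = lls-complete f h<f }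

  llsSum : ℕ → ℕ → Seq
  llsSum f w h = sumOver wt (lls f h w)

  llsSum-suc : ∀ f w h → llsSum (suc f) w h ≡
    iter (suc w) psum δ h + shift (iter r diff (llsSum f (suc w)) ⊖ llsSum f (suc w)) h
  llsSum-suc f w h = begin
    sumOver wt (emptyShape w h ++ pairsWith addRow (increasing⁺ 0 r) G)
      ≡⟨ sumOver-++ wt (emptyShape w h) _ ⟩
    sumOver wt (emptyShape w h) + sumOver wt (pairsWith addRow (increasing⁺ 0 r) G)
      ≡⟨ cong₂ _+_ empty-sum (sumOver-pairsWith addRow wt (increasing⁺ 0 r) G) ⟩
    iter (suc w) psum δ h + sumOver (λ ρ → sumOver (wt ∘ addRow ρ) (G ρ)) (increasing⁺ 0 r)
      ≡⟨ cong (λ s → iter (suc w) psum δ h + s) (sumOver-cong (increasing⁺ 0 r) (λ {ρ} _ → row-sum ρ)) ⟩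
    iter (suc w) psum δ h + sumOver (λ ρ → signedShift (length ρ) (shift S) h) (increasing⁺ 0 r)
      ≡⟨ cong (λ s → iter (suc w) psum δ h + s) (increasing⁺-binomial 0 r (shift S) h) ⟩
    iter (suc w) psum δ h + (iter r diff (shift S) h - shift S h)
      ≡⟨ cong (λ s → iter (suc w) psum δ h + (s - shift S h))
              (iter-commute diff-causal shift-causal diff-shift r 1 S h) ⟩
    iter (suc w) psum δ h + (shift (iter r diff S) h - shift S h)
      ≡⟨ cong (λ s → iter (suc w) psum δ h + s) (shift-⊖ (iter r diff S) S h) ⟨
    iter (suc w) psum δ h + shift (iter r diff S ⊖ S) h ∎
    where
    S = llsSum f (suc w)
    next = λ h′ → lls f h′ (suc w)
    G = λ ρ → shiftList (suc (length ρ)) next h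

    empty-sum : sumOver wt (emptyShape w h) ≡ iter (suc w) psum δ h
    empty-sum = begin
      sumOver wt (emptyShape w h)          ≡⟨ sumOver-map wt _ (monotone w 0 h) ⟩
      sumOver (λ _ → + 1) (monotone w 0 h) ≡⟨ sumOver-one (monotone w 0 h) ⟩
      + length (monotone w 0 h)            ≡⟨ monotone-count w 0 h ⟩
      iter (suc w) psum δ h                ∎

    parts-positive : ∀ {ρ y} → y ∈ G ρ → All (0 <_) (proj₁ y)
    parts-positive {ρ} y∈
      with (_ , parts) , _ ← lls-sound f (proj₂ (∈-shiftList⁻ {F = next} (suc (length ρ)) {h} y∈)) =
      All.map (λ (2≤a , _) → ℕP.<-trans z<s 2≤a) parts

    row-sum : ∀ ρ → sumOver (wt ∘ addRow ρ) (G ρ) ≡ signedShift (length ρ) (shift S) h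
    row-sum ρ = begin
      sumOver (wt ∘ addRow ρ) (G ρ)
        ≡⟨ sumOver-cong (G ρ) (λ {y} y∈ → wt-addRow ρ y (parts-positive {ρ} y∈)) ⟩
      sumOver (λ y → minusOnePow (length ρ) * wt y) (G ρ)
        ≡⟨ sumOver-*ˡ (minusOnePow (length ρ)) wt (G ρ) ⟩
      minusOnePow (length ρ) * sumOver wt (G ρ)
        ≡⟨ cong (minusOnePow (length ρ) *_) (sumOver-shiftList {F = next} wt (suc (length ρ)) h) ⟩
      minusOnePow (length ρ) * iter (suc (length ρ)) shift S h
        ≡⟨ cong (λ f → minusOnePow (length ρ) * f h) (iter-suc′ shift (length ρ) S) ⟨
      signedShift (length ρ) (shift S) h ∎

  -- geom B is the polynomial ∑_{i ≤ B} (x (1 - x)^r)^i, which agrees with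
  -- 1/(1 - x (1 - x)^r) below degree B + 1.
  geom : ℕ → Seq
  geom zero    = δ
  geom (suc B) = δ ⊕ shift (iter r diff (geom B))

  geom-stable : ∀ B → AgreeBelow (suc B) (geom B) (geom (suc B))
  geom-stable zero    {zero}  _           = refl
  geom-stable zero    {suc _} (s≤s ())
  geom-stable (suc B) {i} i< =
    cong (λ s → δ i + s) (shift-agree (suc B) (iter-causal diff-causal r (suc B) (geom-stable B)) i<)

  -- (1 - x)^-w geom B satisfies the recursion of llsSum-suc up to degree B.
  geom-solves : ∀ w B h → h ≤ B →
    iter (suc w) psum δ h + shift (iter r diff (iter (suc w) psum (geom B)) ⊖ iter (suc w) psum (geom B)) h
      ≡ iter w psum (geom B) h
  geom-solves w B h h≤B = begin
    A h + shift (iter r diff G ⊖ G) h                        ≡⟨ cong (λ s → A h + s) (shift-⊖ (iter r diff G) G h) ⟩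
    A h + (shift (iter r diff G) h - shift G h)              ≡⟨ ℤP.+-assoc (A h) _ _ ⟨
    A h + shift (iter r diff G) h - shift G h                ≡⟨ cong (λ s → A h + s - shift G h) diff-inside ⟩
    A h + iter (suc w) psum (shift (iter r diff (geom B))) h - shift G h
      ≡⟨ cong (_- shift G h) (iter-additive psum-causal psum-additive (suc w) δ (shift (iter r diff (geom B))) h) ⟨
    iter (suc w) psum (geom (suc B)) h - shift G h
      ≡⟨ cong (_- shift G h) (iter-causal psum-causal (suc w) (suc B) (sym ∘′ geom-stable B) (s≤s h≤B)) ⟩
    G h - shift G h                                          ≡⟨ diff-psum (iter w psum (geom B)) h ⟩
    iter w psum (geom B) h                                   ∎
    where
    A = iter (suc w) psum δ
    G = iter (suc w) psum (geom B)
    diff-inside : shift (iter r diff G) h ≡ iter (suc w) psum (shift (iter r diff (geom B))) h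
    diff-inside = ≡-trans
      (causal⇒cong shift-causal (iter-commute diff-causal psum-causal diff-psum-commute r (suc w) (geom B)) h)
      (sym (iter-commute psum-causal shift-causal psum-shift (suc w) 1 (iter r diff (geom B)) h))

  llsSum-geom : ∀ f w B h → h < f → h ≤ B → llsSum f w h ≡ iter w psum (geom B) h
  llsSum-geom (suc f) w B h h<1+f h≤B = begin
    llsSum (suc f) w h                                     ≡⟨ llsSum-suc f w h ⟩
    iter (suc w) psum δ h + shift (iter r diff S ⊖ S) h
      ≡⟨ cong (λ s → iter (suc w) psum δ h + s) (shift-agree h agree′ ℕP.≤-refl) ⟩
    iter (suc w) psum δ h + shift (iter r diff G ⊖ G) h   ≡⟨ geom-solves w B h h≤B ⟩
    iter w psum (geom B) h                                 ∎
    where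
    S = llsSum f (suc w)
    G = iter (suc w) psum (geom B)
    agree : AgreeBelow h S G
    agree i<h = llsSum-geom f (suc w) B _ (ℕP.<-≤-trans i<h (ℕP.≤-pred h<1+f)) (ℕP.≤-trans (ℕP.<⇒≤ i<h) h≤B)
    agree′ : AgreeBelow h (iter r diff S ⊖ S) (iter r diff G ⊖ G)
    agree′ i<h = cong₂ _-_ (iter-causal diff-causal r h agree i<h) (agree i<h)

  geom-coefficient : ∀ n B → iter (r ℕ.* B ℕ.+ n ℕ.+ 1) psum (geom B) B ≡ + rhs B n r
  geom-coefficient n zero    = iter-psum-zero (r ℕ.* 0 ℕ.+ n ℕ.+ 1) δ
  geom-coefficient n (suc B) = begin
    iter W psum (δ ⊕ shift (iter r diff (geom B))) (suc B)
      ≡⟨ iter-additive psum-causal psum-additive W δ (shift (iter r diff (geom B))) (suc B) ⟩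
    iter W psum δ (suc B) + iter W psum (shift (iter r diff (geom B))) (suc B)
      ≡⟨ cong (λ s → iter W psum δ (suc B) + s)
              (iter-commute psum-causal shift-causal psum-shift W 1 (iter r diff (geom B)) (suc B)) ⟩
    iter W psum δ (suc B) + iter W psum (iter r diff (geom B)) B
      ≡⟨ cong₂ (λ a b → iter a psum δ (suc B) + iter b psum (iter r diff (geom B)) B) W≡1+m W≡W₀+r ⟩
    iter (suc m) psum δ (suc B) + iter (W₀ ℕ.+ r) psum (iter r diff (geom B)) B
      ≡⟨ cong₂ _+_ (psum-δ-binomial m (suc B)) (cong (λ f → f B) (iter-+ psum W₀ r (iter r diff (geom B)))) ⟩
    + ((m ℕ.+ suc B) C suc B) + iter W₀ psum (iter r psum (iter r diff (geom B))) B
      ≡⟨ cong (λ s → + ((m ℕ.+ suc B) C suc B) + s)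
              (causal⇒cong (iter-causal psum-causal W₀) (iter-inverse psum-causal psum-diff r (geom B)) B) ⟩
    + ((m ℕ.+ suc B) C suc B) + iter W₀ psum (geom B) B
      ≡⟨ cong₂ (λ a b → + (a C suc B) + b) m+[1+B]≡[1+r][1+B]+n (geom-coefficient n B) ⟩
    + ((suc r ℕ.* suc B ℕ.+ n) C suc B ℕ.+ rhs B n r)
      ≡⟨ cong +_ (≡-trans (ℕP.+-comm _ (rhs B n r)) (sym (rhs-suc B n r))) ⟩
    + rhs (suc B) n r ∎
    where
    W  = r ℕ.* suc B ℕ.+ n ℕ.+ 1
    W₀ = r ℕ.* B ℕ.+ n ℕ.+ 1
    m  = r ℕ.* suc B ℕ.+ n
    W≡1+m : W ≡ suc m
    W≡1+m = ℕP.+-comm m 1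
    W≡W₀+r : W ≡ W₀ ℕ.+ r
    W≡W₀+r = ℕ-solve r B n
      where
      ℕ-solve : ∀ r B n → r ℕ.* suc B ℕ.+ n ℕ.+ 1 ≡ r ℕ.* B ℕ.+ n ℕ.+ 1 ℕ.+ r
      ℕ-solve = ℕSolver.solve-∀
    m+[1+B]≡[1+r][1+B]+n : m ℕ.+ suc B ≡ suc r ℕ.* suc B ℕ.+ n
    m+[1+B]≡[1+r][1+B]+n = ℕ-solve r B n
      where
      ℕ-solve : ∀ r B n → r ℕ.* suc B ℕ.+ n ℕ.+ suc B ≡ suc r ℕ.* suc B ℕ.+ n
      ℕ-solve = ℕSolver.solve-∀

theorem3p1 : (k n r : ℕ) (xs : List LLS) →
    Unique xs →
    (∀ x → (x ∈ xs → InX k n r x) × (InX k n r x → x ∈ xs)) →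
    sumℤ (map wt xs) ≡ + rhs k n r
theorem3p1 k n r xs xs-unique xs-members = begin
  sumOver wt xs            ≡⟨ sumOver-enumerations wt xs-enumerates (lls-enumerates w (ℕP.n<1+n k)) ⟩
  llsSum (suc k) w k       ≡⟨ llsSum-geom (suc k) w k k (ℕP.n<1+n k) ℕP.≤-refl ⟩
  iter w psum (geom k) k   ≡⟨ geom-coefficient n k ⟩
  + rhs k n r              ∎
  where
  open LatticeSequences r
  w = r ℕ.* k ℕ.+ n ℕ.+ 1
  xs-enumerates : Enumerates (InX k n r) xs
  xs-enumerates = record { unique = xs-unique ; sound = proj₁ (xs-members _) ; complete = proj₂ (xs-members _) }
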